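{- For all integers $m_1,m_2\ge1$, $$\sum_{k_2\ge1}\sum_{k_1\ge1}\frac{\prod_{i=1}^{m_1}q^{2k_1+2i-1}}{\prod_{i=0}^{m_1}(1+q^{2k_1+2i})}\cdot\frac{\prod_{i=1}^{m_2}q^{2k_1+2k_2+2m_1+2i-1}}{\prod_{i=0}^{m_2}(1+q^{2k_1+2k_2+2m_1+2i})}=\frac{q^{2(m_1+m_2)}\,q^{2m_2}\prod_{i=1}^{m_1+m_2}q^{2i-1}}{(1-q^{2(m_1+m_2)})(1-q^{2m_2})\prod_{i=1}^{m_1+m_2}(1+q^{2i})}.$$
   Context: The identity is understood as an identity of formal power series in $q$ (equivalently, of analytic functions for $|q|<1$). -}

module Defs where

open import Data.Nat as ℕ using (ℕ; zero; suc; _≡ᵇ_; _∸_)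
open import Data.Integer as ℤ using (ℤ; 0ℤ; 1ℤ)
open import Data.Bool using (if_then_else_)

-- Formal power series in q with integer coefficients: n ↦ [q^n] f.
PS : Set
PS = ℕ → ℤ

Σ< : ℕ → (ℕ → ℤ) → ℤ
Σ< zero    f = 0ℤ
Σ< (suc n) f = Σ< n f ℤ.+ f n

0ₛ : PS
0ₛ _ = 0ℤ

1ₛ : PS
1ₛ zero    = 1ℤ
1ₛ (suc _) = 0ℤ

q^ : ℕ → PS
q^ e n = if n ≡ᵇ e then 1ℤ else 0ℤ

infixl 6 _+ₛ_ _-ₛ_
infixl 7 _*ₛ_

_+ₛ_ : PS → PS → PS
(f +ₛ g) n = f n ℤ.+ g n

_-ₛ_ : PS → PS → PS
(f -ₛ g) n = f n ℤ.- g n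

_*ₛ_ : PS → PS → PS
(f *ₛ g) n = Σ< (suc n) (λ i → f i ℤ.* g (n ∸ i))

powₛ : PS → ℕ → PS
powₛ f zero    = 1ₛ
powₛ f (suc j) = powₛ f j *ₛ f

-- Multiplicative inverse of a series with constant term 1:
-- 1/f = Σ_{j ≥ 0} (1 - f)^j ; the coefficient of q^n only involves j ≤ n
-- since (1 - f) has zero constant term.
invₛ : PS → PS
invₛ f n = Σ< (suc n) (λ j → powₛ (1ₛ -ₛ f) j n)

-- Quotient f / g (for g with constant term 1).
_/ₛ_ : PS → PS → PS
f /ₛ g = f *ₛ invₛ g

∏[_,_] : ℕ → ℕ → (ℕ → PS) → PS
∏[ a , b ] F = go (suc b ∸ a)
  where
  go : ℕ → PS
  go zero    = 1ₛ
  go (suc k) = go k *ₛ F (a ℕ.+ k)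

∑[_,_] : ℕ → ℕ → (ℕ → PS) → PS
∑[ a , b ] F = go (suc b ∸ a)
  where
  go : ℕ → PS
  go zero    = 0ₛ
  go (suc k) = go k +ₛ F (a ℕ.+ k)

term : ℕ → ℕ → ℕ → ℕ → PS
term m₁ m₂ k₁ k₂ =
  (∏[ 1 , m₁ ] (λ i → q^ (2 ℕ.* k₁ ℕ.+ 2 ℕ.* i ∸ 1))
    /ₛ ∏[ 0 , m₁ ] (λ i → 1ₛ +ₛ q^ (2 ℕ.* k₁ ℕ.+ 2 ℕ.* i)))
  *ₛ
  (∏[ 1 , m₂ ] (λ i → q^ (2 ℕ.* k₁ ℕ.+ 2 ℕ.* k₂ ℕ.+ 2 ℕ.* m₁ ℕ.+ 2 ℕ.* i ∸ 1))
    /ₛ ∏[ 0 , m₂ ] (λ i → 1ₛ +ₛ q^ (2 ℕ.* k₁ ℕ.+ 2 ℕ.* k₂ ℕ.+ 2 ℕ.* m₁ ℕ.+ 2 ℕ.* i)))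

partialLHS : ℕ → ℕ → ℕ → PS
partialLHS m₁ m₂ K = ∑[ 1 , K ] (λ k₂ → ∑[ 1 , K ] (λ k₁ → term m₁ m₂ k₁ k₂))

rhs : ℕ → ℕ → PS
rhs m₁ m₂ =
  (q^ (2 ℕ.* (m₁ ℕ.+ m₂)) *ₛ q^ (2 ℕ.* m₂) *ₛ ∏[ 1 , m₁ ℕ.+ m₂ ] (λ i → q^ (2 ℕ.* i ∸ 1)))
  /ₛ ((1ₛ -ₛ q^ (2 ℕ.* (m₁ ℕ.+ m₂))) *ₛ (1ₛ -ₛ q^ (2 ℕ.* m₂))
       *ₛ ∏[ 1 , m₁ ℕ.+ m₂ ] (λ i → 1ₛ +ₛ q^ (2 ℕ.* i)))

{-# OPTIONS --safe #-}
module Submission where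

-- The summand is block m₁ (2k₁) · block m₂ (2k₁ + 2k₂ + 2m₁), where
-- block m t = q^(tm + m²) / (−q^t; q²)_(m+1).  With Γ m t = q^(tm + m²) / (−q^t; q²)_m,
--   (1 − q^(2m)) · block m t = Γ m t − Γ m (t + 2),
-- so the sum over k₂ telescopes, and  block m₁ t · Γ m₂ (t + 2m₁ + 2) = q^(2m₂) · block (m₁ + m₂) t
-- turns what is left into a sum over k₁ that telescopes again, to
-- q^(2m₂) · Γ (m₁ + m₂) 2 / ((1 − q^(2m₂)) (1 − q^(2(m₁ + m₂)))), the right-hand side.
-- The discarded tails Γ m (s + 2K) are O(q^K), so the K-th partial sum agrees with it below degree K.

open import Defs
open import Algebra.Bundles using (CommutativeRing)
import Algebra.Solver.Ring
open import Algebra.Solver.Ring.AlmostCommutativeRing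
  using (AlmostCommutativeRing; fromCommutativeRing; _-Raw-AlmostCommutative⟶_)
open import Data.Integer as ℤ using (ℤ; 0ℤ; 1ℤ; +_; -[1+_])
import Data.Integer.Properties as ℤP
import Data.Integer.Tactic.RingSolver as ℤ-Solver
open import Algebra.Properties.CommutativeSemigroup ℤP.+-commutativeSemigroup
  using (interchange)
open import Data.Maybe using (Maybe; just; nothing)
open import Data.Nat as ℕ using (ℕ; zero; suc; _+_; _*_; _∸_; _≤_; _<_; z≤n; s≤s)
import Data.Nat.Properties as ℕP
import Data.Nat.Tactic.RingSolver as ℕ-Solver
open import Data.Product using (_,_; ∃-syntax)
open import Relation.Binary.Bundles using (Setoid)
open import Relation.Binary.PropositionalEquality
import Relation.Binary.Reasoning.Setoid as SetoidReasoning
open import Relation.Nullary using (yes; no)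

Σ<-cong : ∀ n {F G : ℕ → ℤ} → (∀ i → i < n → F i ≡ G i) → Σ< n F ≡ Σ< n G
Σ<-cong zero    F≡G = refl
Σ<-cong (suc n) F≡G =
  cong₂ ℤ._+_ (Σ<-cong n (λ i i<n → F≡G i (ℕP.m<n⇒m<1+n i<n))) (F≡G n ℕP.≤-refl)

Σ<-zero : ∀ n {F : ℕ → ℤ} → (∀ i → i < n → F i ≡ 0ℤ) → Σ< n F ≡ 0ℤ
Σ<-zero n F≡0 = trans (Σ<-cong n F≡0) (Σ<-const0 n)
  where
  Σ<-const0 : ∀ n → Σ< n (λ _ → 0ℤ) ≡ 0ℤ
  Σ<-const0 zero    = refl
  Σ<-const0 (suc n) = cong (ℤ._+ 0ℤ) (Σ<-const0 n)

Σ<-first : ∀ n (F : ℕ → ℤ) → Σ< (suc n) F ≡ F 0 ℤ.+ Σ< n (λ i → F (suc i))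
Σ<-first zero    F = trans (ℤP.+-identityˡ (F 0)) (sym (ℤP.+-identityʳ (F 0)))
Σ<-first (suc n) F = trans (cong (ℤ._+ F (suc n)) (Σ<-first n F)) (ℤP.+-assoc (F 0) _ _)

Σ<-reverse : ∀ n (F : ℕ → ℤ) → Σ< n F ≡ Σ< n (λ i → F (n ∸ suc i))
Σ<-reverse zero    F = refl
Σ<-reverse (suc n) F = begin
  Σ< n F ℤ.+ F n                              ≡⟨ cong (ℤ._+ F n) (Σ<-reverse n F) ⟩
  Σ< n (λ i → F (n ∸ suc i)) ℤ.+ F n          ≡⟨ ℤP.+-comm _ (F n) ⟩
  F n ℤ.+ Σ< n (λ i → F (n ∸ suc i))          ≡⟨ Σ<-first n (λ i → F (n ∸ i)) ⟨
  Σ< (suc n) (λ i → F (n ∸ i))                ∎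
  where open ≡-Reasoning

Σ<-+ : ∀ n (F G : ℕ → ℤ) → Σ< n (λ i → F i ℤ.+ G i) ≡ Σ< n F ℤ.+ Σ< n G
Σ<-+ zero    F G = refl
Σ<-+ (suc n) F G =
  trans (cong (ℤ._+ (F n ℤ.+ G n)) (Σ<-+ n F G)) (interchange (Σ< n F) (Σ< n G) (F n) (G n))

Σ<-*ˡ : ∀ n c (F : ℕ → ℤ) → Σ< n (λ i → c ℤ.* F i) ≡ c ℤ.* Σ< n F
Σ<-*ˡ zero    c F = sym (ℤP.*-zeroʳ c)
Σ<-*ˡ (suc n) c F =
  trans (cong (ℤ._+ c ℤ.* F n) (Σ<-*ˡ n c F)) (sym (ℤP.*-distribˡ-+ c (Σ< n F) (F n)))

-- The ring of formal power series

≗-setoid : Setoid _ _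
≗-setoid = ℕ →-setoid ℤ

open Setoid ≗-setoid using () renaming (refl to ≗-refl; sym to ≗-sym; trans to ≗-trans)

tailₛ : PS → PS
tailₛ f n = f (suc n)

scaleₛ : ℤ → PS → PS
scaleₛ c f n = c ℤ.* f n

*ₛ-coeff₀ : ∀ f g → (f *ₛ g) 0 ≡ f 0 ℤ.* g 0
*ₛ-coeff₀ f g = ℤP.+-identityˡ _

*ₛ-coeff-suc : ∀ f g n → (f *ₛ g) (suc n) ≡ f 0 ℤ.* g (suc n) ℤ.+ (tailₛ f *ₛ g) n
*ₛ-coeff-suc f g n = Σ<-first (suc n) (λ i → f i ℤ.* g (suc n ∸ i))

*ₛ-cong : ∀ {f f′ g g′} → f ≗ f′ → g ≗ g′ → f *ₛ g ≗ f′ *ₛ g′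
*ₛ-cong f≗f′ g≗g′ n = Σ<-cong (suc n) (λ i _ → cong₂ ℤ._*_ (f≗f′ i) (g≗g′ (n ∸ i)))

*ₛ-congˡ : ∀ f {g g′} → g ≗ g′ → f *ₛ g ≗ f *ₛ g′
*ₛ-congˡ f = *ₛ-cong {f = f} (λ _ → refl)

*ₛ-congʳ : ∀ h {f f′} → f ≗ f′ → f *ₛ h ≗ f′ *ₛ h
*ₛ-congʳ h f≗f′ = *ₛ-cong {g = h} f≗f′ (λ _ → refl)

+ₛ-cong : ∀ {f f′ g g′} → f ≗ f′ → g ≗ g′ → f +ₛ g ≗ f′ +ₛ g′
+ₛ-cong f≗f′ g≗g′ n = cong₂ ℤ._+_ (f≗f′ n) (g≗g′ n)

+ₛ-congˡ : ∀ f {g g′} → g ≗ g′ → f +ₛ g ≗ f +ₛ g′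
+ₛ-congˡ f = +ₛ-cong {f = f} (λ _ → refl)

*ₛ-comm : ∀ f g → f *ₛ g ≗ g *ₛ f
*ₛ-comm f g n = trans (Σ<-reverse (suc n) _) (Σ<-cong (suc n) swap)
  where
  swap : ∀ i → i < suc n → f (n ∸ i) ℤ.* g (n ∸ (n ∸ i)) ≡ g i ℤ.* f (n ∸ i)
  swap i (s≤s i≤n) =
    trans (ℤP.*-comm (f (n ∸ i)) _) (cong (λ j → g j ℤ.* f (n ∸ i)) (ℕP.m∸[m∸n]≡n i≤n))

*ₛ-zeroˡ : ∀ f → 0ₛ *ₛ f ≗ 0ₛ
*ₛ-zeroˡ f n = Σ<-zero (suc n) (λ i _ → ℤP.*-zeroˡ (f (n ∸ i)))

*ₛ-identityˡ : ∀ f → 1ₛ *ₛ f ≗ f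
*ₛ-identityˡ f zero    = trans (*ₛ-coeff₀ 1ₛ f) (ℤP.*-identityˡ (f 0))
*ₛ-identityˡ f (suc n) = begin
  (1ₛ *ₛ f) (suc n)                     ≡⟨ *ₛ-coeff-suc 1ₛ f n ⟩
  1ℤ ℤ.* f (suc n) ℤ.+ (0ₛ *ₛ f) n      ≡⟨ cong₂ ℤ._+_ (ℤP.*-identityˡ (f (suc n))) (*ₛ-zeroˡ f n) ⟩
  f (suc n) ℤ.+ 0ℤ                      ≡⟨ ℤP.+-identityʳ (f (suc n)) ⟩
  f (suc n)                             ∎
  where open ≡-Reasoning

*ₛ-distribʳ : ∀ h f g → (f +ₛ g) *ₛ h ≗ f *ₛ h +ₛ g *ₛ h
*ₛ-distribʳ h f g n =
  trans (Σ<-cong (suc n) (λ i _ → ℤP.*-distribʳ-+ (h (n ∸ i)) (f i) (g i))) (Σ<-+ (suc n) _ _)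

scaleₛ-*ₛ : ∀ c f g → scaleₛ c f *ₛ g ≗ scaleₛ c (f *ₛ g)
scaleₛ-*ₛ c f g n =
  trans (Σ<-cong (suc n) (λ i _ → ℤP.*-assoc c (f i) (g (n ∸ i)))) (Σ<-*ˡ (suc n) c _)

-- Induction on the degree, splitting f as f 0 + q · tailₛ f.
*ₛ-assoc : ∀ f g h → (f *ₛ g) *ₛ h ≗ f *ₛ (g *ₛ h)
*ₛ-assoc f g h zero = begin
  ((f *ₛ g) *ₛ h) 0           ≡⟨ trans (*ₛ-coeff₀ (f *ₛ g) h) (cong (ℤ._* h 0) (*ₛ-coeff₀ f g)) ⟩
  f 0 ℤ.* g 0 ℤ.* h 0         ≡⟨ ℤP.*-assoc (f 0) (g 0) (h 0) ⟩
  f 0 ℤ.* (g 0 ℤ.* h 0)       ≡⟨ trans (*ₛ-coeff₀ f (g *ₛ h)) (cong (f 0 ℤ.*_) (*ₛ-coeff₀ g h)) ⟨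
  (f *ₛ (g *ₛ h)) 0           ∎
  where open ≡-Reasoning
*ₛ-assoc f g h (suc n) = begin
  ((f *ₛ g) *ₛ h) (suc n)
    ≡⟨ *ₛ-coeff-suc (f *ₛ g) h n ⟩
  (f *ₛ g) 0 ℤ.* h (suc n) ℤ.+ (tailₛ (f *ₛ g) *ₛ h) n
    ≡⟨ cong₂ ℤ._+_ (cong (ℤ._* h (suc n)) (*ₛ-coeff₀ f g))
                   (trans (*ₛ-congʳ h (*ₛ-coeff-suc f g) n)
                          (*ₛ-distribʳ h (scaleₛ (f 0) (tailₛ g)) (tailₛ f *ₛ g) n)) ⟩
  f 0 ℤ.* g 0 ℤ.* h (suc n) ℤ.+ ((scaleₛ (f 0) (tailₛ g) *ₛ h) n ℤ.+ ((tailₛ f *ₛ g) *ₛ h) n)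
    ≡⟨ cong (λ x → f 0 ℤ.* g 0 ℤ.* h (suc n) ℤ.+ x)
            (cong₂ ℤ._+_ (scaleₛ-*ₛ (f 0) (tailₛ g) h n) (*ₛ-assoc (tailₛ f) g h n)) ⟩
  f 0 ℤ.* g 0 ℤ.* h (suc n) ℤ.+ (f 0 ℤ.* (tailₛ g *ₛ h) n ℤ.+ (tailₛ f *ₛ (g *ₛ h)) n)
    ≡⟨ regroup (f 0) (g 0) (h (suc n)) _ _ ⟩
  f 0 ℤ.* (g 0 ℤ.* h (suc n) ℤ.+ (tailₛ g *ₛ h) n) ℤ.+ (tailₛ f *ₛ (g *ₛ h)) n
    ≡⟨ cong (λ x → f 0 ℤ.* x ℤ.+ (tailₛ f *ₛ (g *ₛ h)) n) (*ₛ-coeff-suc g h n) ⟨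
  f 0 ℤ.* (g *ₛ h) (suc n) ℤ.+ (tailₛ f *ₛ (g *ₛ h)) n
    ≡⟨ *ₛ-coeff-suc f (g *ₛ h) n ⟨
  (f *ₛ (g *ₛ h)) (suc n) ∎
  where
  open ≡-Reasoning
  regroup : ∀ a b c x y → a ℤ.* b ℤ.* c ℤ.+ (a ℤ.* x ℤ.+ y) ≡ a ℤ.* (b ℤ.* c ℤ.+ x) ℤ.+ y
  regroup = ℤ-Solver.solve-∀

PS-commutativeRing : CommutativeRing _ _
PS-commutativeRing = record
  { Carrier = PS ; _≈_ = _≗_ ; _+_ = _+ₛ_ ; _*_ = _*ₛ_ ; -_ = negₛ ; 0# = 0ₛ ; 1# = 1ₛ
  ; isCommutativeRing = record
    { isRing = record
      { +-isAbelianGroup = record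
        { isGroup = record
          { isMonoid = record
            { isSemigroup = record
              { isMagma = record { isEquivalence = Setoid.isEquivalence ≗-setoid ; ∙-cong = +ₛ-cong }
              ; assoc = λ f g h n → ℤP.+-assoc (f n) (g n) (h n) }
            ; identity = (λ f n → ℤP.+-identityˡ (f n)) , (λ f n → ℤP.+-identityʳ (f n)) }
          ; inverse = (λ f n → ℤP.+-inverseˡ (f n)) , (λ f n → ℤP.+-inverseʳ (f n))
          ; ⁻¹-cong = λ f≗g n → cong ℤ.-_ (f≗g n) }
        ; comm = λ f g n → ℤP.+-comm (f n) (g n) }
      ; *-cong = *ₛ-cong
      ; *-assoc = *ₛ-assoc
      ; *-identity = *ₛ-identityˡ , λ f → ≗-trans (*ₛ-comm f 1ₛ) (*ₛ-identityˡ f)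
      ; distrib = (λ h f g → ≗-trans (*ₛ-comm h (f +ₛ g))
                     (≗-trans (*ₛ-distribʳ h f g) (+ₛ-cong (*ₛ-comm f h) (*ₛ-comm g h))))
                , *ₛ-distribʳ }
    ; *-comm = *ₛ-comm } }
  where
  negₛ : PS → PS
  negₛ f n = ℤ.- f n

-- The clauses for 0 and 1 make the solver's constants 0 and 1 definitionally 0ₛ and 1ₛ.
constₛ : ℤ → PS
constₛ (+ 0)     = 0ₛ
constₛ (+ 1)     = 1ₛ
constₛ c zero    = c
constₛ c (suc _) = 0ℤ

constₛ-coeff₀ : ∀ c → constₛ c 0 ≡ c
constₛ-coeff₀ (+ 0)           = refl
constₛ-coeff₀ (+ 1)           = refl
constₛ-coeff₀ (+ suc (suc _)) = refl
constₛ-coeff₀ -[1+ _ ]        = refl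

constₛ-coeff-suc : ∀ c n → constₛ c (suc n) ≡ 0ℤ
constₛ-coeff-suc (+ 0)           n = refl
constₛ-coeff-suc (+ 1)           n = refl
constₛ-coeff-suc (+ suc (suc _)) n = refl
constₛ-coeff-suc -[1+ _ ]        n = refl

PS-almostCommutativeRing : AlmostCommutativeRing _ _
PS-almostCommutativeRing = fromCommutativeRing PS-commutativeRing

constₛ-homomorphism :
  CommutativeRing.rawRing ℤP.+-*-commutativeRing -Raw-AlmostCommutative⟶ PS-almostCommutativeRing
constₛ-homomorphism = record
  { ⟦_⟧    = constₛ
  ; +-homo = +-homo
  ; *-homo = *-homo
  ; -‿homo = -‿homo
  ; 0-homo = λ _ → refl
  ; 1-homo = λ _ → refl
  }
  where
  +-homo : ∀ a b → constₛ (a ℤ.+ b) ≗ constₛ a +ₛ constₛ b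
  +-homo a b zero    =
    trans (constₛ-coeff₀ (a ℤ.+ b)) (sym (cong₂ ℤ._+_ (constₛ-coeff₀ a) (constₛ-coeff₀ b)))
  +-homo a b (suc n) =
    trans (constₛ-coeff-suc (a ℤ.+ b) n)
          (sym (cong₂ ℤ._+_ (constₛ-coeff-suc a n) (constₛ-coeff-suc b n)))
  -‿homo : ∀ a n → constₛ (ℤ.- a) n ≡ ℤ.- constₛ a n
  -‿homo a zero    = trans (constₛ-coeff₀ (ℤ.- a)) (cong ℤ.-_ (sym (constₛ-coeff₀ a)))
  -‿homo a (suc n) = trans (constₛ-coeff-suc (ℤ.- a) n) (cong ℤ.-_ (sym (constₛ-coeff-suc a n)))
  *-homo : ∀ a b → constₛ (a ℤ.* b) ≗ constₛ a *ₛ constₛ b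
  *-homo a b zero = sym (trans (*ₛ-coeff₀ (constₛ a) (constₛ b))
    (trans (cong₂ ℤ._*_ (constₛ-coeff₀ a) (constₛ-coeff₀ b)) (sym (constₛ-coeff₀ (a ℤ.* b)))))
  *-homo a b (suc n) = begin
    constₛ (a ℤ.* b) (suc n)   ≡⟨ constₛ-coeff-suc (a ℤ.* b) n ⟩
    0ℤ                         ≡⟨ Σ<-zero (suc (suc n)) vanish ⟨
    (constₛ a *ₛ constₛ b) (suc n) ∎
    where
    open ≡-Reasoning
    vanish : ∀ i → i < suc (suc n) → constₛ a i ℤ.* constₛ b (suc n ∸ i) ≡ 0ℤ
    vanish zero    _ =
      trans (cong (constₛ a 0 ℤ.*_) (constₛ-coeff-suc b n)) (ℤP.*-zeroʳ (constₛ a 0))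
    vanish (suc i) _ =
      trans (cong (ℤ._* constₛ b (n ∸ i)) (constₛ-coeff-suc a i)) (ℤP.*-zeroˡ (constₛ b (n ∸ i)))

constₛ-≟ : ∀ a b → Maybe (constₛ a ≗ constₛ b)
constₛ-≟ a b with a ℤ.≟ b
... | yes refl = just ≗-refl
... | no _     = nothing

open Algebra.Solver.Ring (CommutativeRing.rawRing ℤP.+-*-commutativeRing)
  PS-almostCommutativeRing constₛ-homomorphism constₛ-≟
  using (solve; _:=_; _:+_; _:-_; _:*_; con)

open CommutativeRing PS-commutativeRing
  using (*-assoc; *-comm; *-identityʳ; distribˡ; zeroʳ)

module ≗-Reasoning = SetoidReasoning ≗-setoid

-ₛ-cong : ∀ {f f′ g g′} → f ≗ f′ → g ≗ g′ → f -ₛ g ≗ f′ -ₛ g′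
-ₛ-cong f≗f′ g≗g′ n = cong₂ ℤ._-_ (f≗f′ n) (g≗g′ n)

-- f ≗[< v ] g  is  f ≡ g (mod q^v).
infix 4 _≗[<_]_
_≗[<_]_ : PS → ℕ → PS → Set
f ≗[< v ] g = ∀ n → n < v → f n ≡ g n

≗⇒≗[<] : ∀ {f g v} → f ≗ g → f ≗[< v ] g
≗⇒≗[<] f≗g n _ = f≗g n

≗[<]-setoid : ℕ → Setoid _ _
≗[<]-setoid v = record
  { Carrier = PS
  ; _≈_ = _≗[< v ]_
  ; isEquivalence = record
    { refl = λ _ _ → refl
    ; sym = λ f≗g n n<v → sym (f≗g n n<v)
    ; trans = λ f≗g g≗h n n<v → trans (f≗g n n<v) (g≗h n n<v) } }

≗[<]-weaken : ∀ {f g v w} → w ≤ v → f ≗[< v ] g → f ≗[< w ] g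
≗[<]-weaken w≤v f≗g n n<w = f≗g n (ℕP.<-≤-trans n<w w≤v)

*ₛ-cong-≗[<] : ∀ {f f′ g g′ v} → f ≗[< v ] f′ → g ≗[< v ] g′ → f *ₛ g ≗[< v ] f′ *ₛ g′
*ₛ-cong-≗[<] f≗f′ g≗g′ n n<v = Σ<-cong (suc n) λ i i≤n →
  cong₂ ℤ._*_ (f≗f′ i (ℕP.≤-<-trans (ℕP.≤-pred i≤n) n<v))
              (g≗g′ (n ∸ i) (ℕP.≤-<-trans (ℕP.m∸n≤m n i) n<v))

-ₛ-≗[<]0 : ∀ f {g v} → g ≗[< v ] 0ₛ → f -ₛ g ≗[< v ] f
-ₛ-≗[<]0 f g≗0 n n<v = trans (cong (λ x → f n ℤ.- x) (g≗0 n n<v)) (ℤP.+-identityʳ (f n))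

*ₛ-≗[<]0ʳ : ∀ {g v} f → g ≗[< v ] 0ₛ → f *ₛ g ≗[< v ] 0ₛ
*ₛ-≗[<]0ʳ f g≗0 n n<v = trans (*ₛ-cong-≗[<] {f = f} (λ _ _ → refl) g≗0 n n<v) (zeroʳ f n)

*ₛ-≗[<]0-suc : ∀ {u g v} → u ≗[< 1 ] 0ₛ → g ≗[< v ] 0ₛ → u *ₛ g ≗[< suc v ] 0ₛ
*ₛ-≗[<]0-suc {u} {g} u₀≡0 g≗0 zero _ =
  trans (*ₛ-coeff₀ u g) (trans (cong (ℤ._* g 0) (u₀≡0 0 (s≤s z≤n))) (ℤP.*-zeroˡ (g 0)))
*ₛ-≗[<]0-suc {u} {g} u₀≡0 g≗0 (suc n) (s≤s n<v) = begin
  (u *ₛ g) (suc n)                             ≡⟨ *ₛ-coeff-suc u g n ⟩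
  u 0 ℤ.* g (suc n) ℤ.+ (tailₛ u *ₛ g) n       ≡⟨ cong₂ ℤ._+_ (cong (ℤ._* g (suc n)) (u₀≡0 0 (s≤s z≤n)))
                                                            (*ₛ-≗[<]0ʳ (tailₛ u) g≗0 n n<v) ⟩
  0ℤ ℤ.* g (suc n) ℤ.+ 0ℤ                      ≡⟨ ℤP.+-identityʳ _ ⟩
  0ℤ ℤ.* g (suc n)                             ≡⟨ ℤP.*-zeroˡ (g (suc n)) ⟩
  0ℤ                                           ∎
  where open ≡-Reasoning

powₛ-≗[<]0 : ∀ {u} → u ≗[< 1 ] 0ₛ → ∀ j → powₛ u j ≗[< j ] 0ₛ
powₛ-≗[<]0 u₀≡0 zero    n ()
powₛ-≗[<]0 {u} u₀≡0 (suc j) n n<1+j =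
  trans (*-comm (powₛ u j) u n) (*ₛ-≗[<]0-suc u₀≡0 (powₛ-≗[<]0 u₀≡0 j) n n<1+j)

shiftₛ : ℕ → PS → PS
shiftₛ zero    f         = f
shiftₛ (suc e) f zero    = 0ℤ
shiftₛ (suc e) f (suc n) = shiftₛ e f n

q^0≗1ₛ : q^ 0 ≗ 1ₛ
q^0≗1ₛ zero    = refl
q^0≗1ₛ (suc n) = refl

q^-*ₛ : ∀ e f → q^ e *ₛ f ≗ shiftₛ e f
q^-*ₛ zero    f         = ≗-trans (*ₛ-cong {g = f} q^0≗1ₛ ≗-refl) (*ₛ-identityˡ f)
q^-*ₛ (suc e) f zero    = trans (*ₛ-coeff₀ (q^ (suc e)) f) (ℤP.*-zeroˡ (f 0))
q^-*ₛ (suc e) f (suc n) = trans (*ₛ-coeff-suc (q^ (suc e)) f n)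
  (trans (cong₂ ℤ._+_ (ℤP.*-zeroˡ (f (suc n))) (q^-*ₛ e f n)) (ℤP.+-identityˡ _))

shiftₛ-q^ : ∀ e b → shiftₛ e (q^ b) ≗ q^ (e + b)
shiftₛ-q^ zero    b n       = refl
shiftₛ-q^ (suc e) b zero    = refl
shiftₛ-q^ (suc e) b (suc n) = shiftₛ-q^ e b n

shiftₛ-≗[<]0 : ∀ e f → shiftₛ e f ≗[< e ] 0ₛ
shiftₛ-≗[<]0 (suc e) f zero    _         = refl
shiftₛ-≗[<]0 (suc e) f (suc n) (s≤s n<e) = shiftₛ-≗[<]0 e f n n<e

q^-*ₛ-q^ : ∀ a b → q^ a *ₛ q^ b ≗ q^ (a + b)
q^-*ₛ-q^ a b = ≗-trans (q^-*ₛ a (q^ b)) (shiftₛ-q^ a b)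

q^-*ₛ-≗[<]0 : ∀ e f → q^ e *ₛ f ≗[< e ] 0ₛ
q^-*ₛ-≗[<]0 e f n n<e = trans (q^-*ₛ e f n) (shiftₛ-≗[<]0 e f n n<e)

q^-cong : ∀ {a b} → a ≡ b → q^ a ≗ q^ b
q^-cong a≡b = cong-app (cong q^ a≡b)

-- Inverses

geometricₛ : PS → ℕ → PS
geometricₛ u N n = Σ< N (λ j → powₛ u j n)

geometricₛ-stable : ∀ {u} → u ≗[< 1 ] 0ₛ → ∀ n d →
  geometricₛ u (d + suc n) n ≡ geometricₛ u (suc n) n
geometricₛ-stable u₀≡0 n zero    = refl
geometricₛ-stable u₀≡0 n (suc d) = trans
  (cong₂ ℤ._+_ (geometricₛ-stable u₀≡0 n d) (powₛ-≗[<]0 u₀≡0 (d + suc n) n (ℕP.m≤n+m (suc n) d)))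
  (ℤP.+-identityʳ _)

*ₛ-geometricₛ : ∀ g N → g *ₛ geometricₛ (1ₛ -ₛ g) N ≗ 1ₛ -ₛ powₛ (1ₛ -ₛ g) N
*ₛ-geometricₛ g zero    n = trans (zeroʳ g n) (sym (ℤP.+-inverseʳ (1ₛ n)))
*ₛ-geometricₛ g (suc N) = begin
  g *ₛ (G +ₛ P)
    ≈⟨ distribˡ g G P ⟩
  g *ₛ G +ₛ g *ₛ P
    ≈⟨ +ₛ-cong (*ₛ-geometricₛ g N) ≗-refl ⟩
  (1ₛ -ₛ P) +ₛ g *ₛ P
    ≈⟨ solve 2 (λ g P → (con 1ℤ :- P) :+ g :* P := con 1ℤ :- P :* (con 1ℤ :- g)) ≗-refl g P ⟩
  1ₛ -ₛ P *ₛ (1ₛ -ₛ g) ∎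
  where
  open ≗-Reasoning
  G = geometricₛ (1ₛ -ₛ g) N
  P = powₛ (1ₛ -ₛ g) N

-- invₛ g truncates the geometric series of 1 − g at a length that grows with the degree;
-- as (1 − g)^j = O(q^j), degrees ≤ n may all use the common length n + 1.
*ₛ-invₛ : ∀ g → g 0 ≡ 1ℤ → g *ₛ invₛ g ≗ 1ₛ
*ₛ-invₛ g g₀≡1 n = begin
  (g *ₛ invₛ g) n
    ≡⟨ Σ<-cong (suc n) (λ i i≤n → cong (g i ℤ.*_) (stable i (ℕP.≤-pred i≤n))) ⟩
  (g *ₛ geometricₛ u (suc n)) n
    ≡⟨ *ₛ-geometricₛ g (suc n) n ⟩
  1ₛ n ℤ.- powₛ u (suc n) n
    ≡⟨ cong (λ x → 1ₛ n ℤ.- x) (powₛ-≗[<]0 u₀≡0 (suc n) n ℕP.≤-refl) ⟩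
  1ₛ n ℤ.- 0ℤ
    ≡⟨ ℤP.+-identityʳ (1ₛ n) ⟩
  1ₛ n ∎
  where
  open ≡-Reasoning
  u = 1ₛ -ₛ g
  u₀≡0 : u ≗[< 1 ] 0ₛ
  u₀≡0 zero    _         = cong (λ x → 1ℤ ℤ.- x) g₀≡1
  u₀≡0 (suc _) (s≤s ())
  stable : ∀ i → i ≤ n → invₛ g (n ∸ i) ≡ geometricₛ u (suc n) (n ∸ i)
  stable i i≤n = trans (sym (geometricₛ-stable u₀≡0 (n ∸ i) i))
    (cong (λ N → geometricₛ u N (n ∸ i)) (trans (ℕP.+-suc i (n ∸ i)) (cong suc (ℕP.m+[n∸m]≡n i≤n))))

*ₛ-/ₛ-cancel : ∀ x {d} → d 0 ≡ 1ℤ → (x *ₛ d) /ₛ d ≗ x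
*ₛ-/ₛ-cancel x {d} d₀≡1 =
  ≗-trans (*-assoc x d (invₛ d)) (≗-trans (*ₛ-congˡ x (*ₛ-invₛ d d₀≡1)) (*-identityʳ x))

/ₛ-*ₛ-cancel : ∀ x {d} → d 0 ≡ 1ℤ → (x /ₛ d) *ₛ d ≗ x
/ₛ-*ₛ-cancel x {d} d₀≡1 = ≗-trans (*-assoc x (invₛ d) d)
  (≗-trans (*ₛ-congˡ x (≗-trans (*-comm (invₛ d) d) (*ₛ-invₛ d d₀≡1))) (*-identityʳ x))

*ₛ-cancelʳ : ∀ {x y} d → d 0 ≡ 1ℤ → x *ₛ d ≗ y *ₛ d → x ≗ y
*ₛ-cancelʳ {x} {y} d d₀≡1 xd≗yd =
  ≗-trans (≗-sym (*ₛ-/ₛ-cancel x d₀≡1)) (≗-trans (*ₛ-congʳ (invₛ d) xd≗yd) (*ₛ-/ₛ-cancel y d₀≡1))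

*ₛ≗⇒≗/ₛ : ∀ {x y} d → d 0 ≡ 1ℤ → y *ₛ d ≗ x → y ≗ x /ₛ d
*ₛ≗⇒≗/ₛ {x} d d₀≡1 yd≗x = *ₛ-cancelʳ d d₀≡1 (≗-trans yd≗x (≗-sym (/ₛ-*ₛ-cancel x d₀≡1)))

*ₛ-coeff₀-one : ∀ f g → f 0 ≡ 1ℤ → g 0 ≡ 1ℤ → (f *ₛ g) 0 ≡ 1ℤ
*ₛ-coeff₀-one f g f₀≡1 g₀≡1 = trans (*ₛ-coeff₀ f g) (cong₂ ℤ._*_ f₀≡1 g₀≡1)

1ₛ-q^-coeff₀ : ∀ {e} → 1 ≤ e → (1ₛ -ₛ q^ e) 0 ≡ 1ℤ
1ₛ-q^-coeff₀ {suc e} _ = refl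

powₛ-cong : ∀ {f g} → f ≗ g → ∀ j → powₛ f j ≗ powₛ g j
powₛ-cong f≗g zero    = ≗-refl
powₛ-cong f≗g (suc j) = *ₛ-cong (powₛ-cong f≗g j) f≗g

invₛ-cong : ∀ {f g} → f ≗ g → invₛ f ≗ invₛ g
invₛ-cong f≗g n = Σ<-cong (suc n) (λ j _ → powₛ-cong (-ₛ-cong {f = 1ₛ} ≗-refl f≗g) j n)

invₛ-*ₛ : ∀ {f g} → f 0 ≡ 1ℤ → g 0 ≡ 1ℤ → invₛ (f *ₛ g) ≗ invₛ f *ₛ invₛ g
invₛ-*ₛ {f} {g} f₀≡1 g₀≡1 = *ₛ-cancelʳ (f *ₛ g) fg₀≡1 (begin
  invₛ (f *ₛ g) *ₛ (f *ₛ g)           ≈⟨ *-comm (invₛ (f *ₛ g)) (f *ₛ g) ⟩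
  (f *ₛ g) *ₛ invₛ (f *ₛ g)           ≈⟨ *ₛ-invₛ (f *ₛ g) fg₀≡1 ⟩
  1ₛ                                  ≈⟨ solve 0 (con 1ℤ := con 1ℤ :* con 1ℤ) ≗-refl ⟩
  1ₛ *ₛ 1ₛ                            ≈⟨ *ₛ-cong (*ₛ-invₛ f f₀≡1) (*ₛ-invₛ g g₀≡1) ⟨
  (f *ₛ invₛ f) *ₛ (g *ₛ invₛ g)      ≈⟨ solve 4 (λ f i g j → (f :* i) :* (g :* j) := (i :* j) :* (f :* g))
                                             ≗-refl f (invₛ f) g (invₛ g) ⟩
  (invₛ f *ₛ invₛ g) *ₛ (f *ₛ g)      ∎)
  where
  open ≗-Reasoning
  fg₀≡1 = *ₛ-coeff₀-one f g f₀≡1 g₀≡1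

/ₛ-cong : ∀ {x x′ d d′} → x ≗ x′ → d ≗ d′ → x /ₛ d ≗ x′ /ₛ d′
/ₛ-cong x≗x′ d≗d′ = *ₛ-cong x≗x′ (invₛ-cong d≗d′)

/ₛ-*ₛ-/ₛ : ∀ x y {d e} → d 0 ≡ 1ℤ → e 0 ≡ 1ℤ → (x /ₛ d) *ₛ (y /ₛ e) ≗ (x *ₛ y) /ₛ (d *ₛ e)
/ₛ-*ₛ-/ₛ x y {d} {e} d₀≡1 e₀≡1 = ≗-trans
  (solve 4 (λ x i y j → (x :* i) :* (y :* j) := (x :* y) :* (i :* j)) ≗-refl x (invₛ d) y (invₛ e))
  (*ₛ-congˡ (x *ₛ y) (≗-sym (invₛ-*ₛ d₀≡1 e₀≡1)))

/ₛ-*ₛ-cancelˡ : ∀ x e {d} → d 0 ≡ 1ℤ → (x /ₛ d) *ₛ (d *ₛ e) ≗ x *ₛ e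
/ₛ-*ₛ-cancelˡ x e {d} d₀≡1 = ≗-trans
  (solve 4 (λ x i d e → (x :* i) :* (d :* e) := (x :* e) :* (d :* i)) ≗-refl x (invₛ d) d e)
  (≗-trans (*ₛ-congˡ (x *ₛ e) (*ₛ-invₛ d d₀≡1)) (*-identityʳ (x *ₛ e)))

-- Finite sums and products of series

≗-by-induction : ∀ {A : Set} {g h : ℕ → A} →
  g 0 ≡ h 0 → (∀ k → g k ≡ h k → g (suc k) ≡ h (suc k)) → g ≗ h
≗-by-induction g₀≡h₀ step zero    = g₀≡h₀
≗-by-induction g₀≡h₀ step (suc k) = step k (≗-by-induction g₀≡h₀ step k)

∏< : ℕ → (ℕ → PS) → PS
∏< zero    F = 1ₛ
∏< (suc k) F = ∏< k F *ₛ F k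

∑< : ℕ → (ℕ → PS) → PS
∑< zero    F = 0ₛ
∑< (suc k) F = ∑< k F +ₛ F k

-- ∏[_,_] and ∑[_,_] recurse through a local function that cannot be named; abstracting
-- the number of factors exposes that function to ≗-by-induction.
∏[]≡∏< : ∀ a b F → ∏[ a , b ] F ≡ ∏< (suc b ∸ a) (λ i → F (a + i))
∏[]≡∏< a b F
  with suc b ∸ a | ≗-by-induction {h = λ j → ∏< j (λ i → F (a + i))} refl (λ j → cong (_*ₛ F (a + j)))
... | k | go≗∏< = go≗∏< k

∑[]≡∑< : ∀ a b F → ∑[ a , b ] F ≡ ∑< (suc b ∸ a) (λ i → F (a + i))
∑[]≡∑< a b F
  with suc b ∸ a | ≗-by-induction {h = λ j → ∑< j (λ i → F (a + i))} refl (λ j → cong (_+ₛ F (a + j)))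
... | k | go≗∑< = go≗∑< k

∏<-cong : ∀ k {F G} → (∀ i → F i ≗ G i) → ∏< k F ≗ ∏< k G
∏<-cong zero    F≗G = ≗-refl
∏<-cong (suc k) F≗G = *ₛ-cong (∏<-cong k F≗G) (F≗G k)

∏<-coeff₀-one : ∀ k F → (∀ i → F i 0 ≡ 1ℤ) → ∏< k F 0 ≡ 1ℤ
∏<-coeff₀-one zero    F F₀≡1 = refl
∏<-coeff₀-one (suc k) F F₀≡1 = *ₛ-coeff₀-one (∏< k F) (F k) (∏<-coeff₀-one k F F₀≡1) (F₀≡1 k)

∑<-cong : ∀ k {F G} → (∀ i → F i ≗ G i) → ∑< k F ≗ ∑< k G
∑<-cong zero    F≗G = ≗-refl
∑<-cong (suc k) F≗G = +ₛ-cong (∑<-cong k F≗G) (F≗G k)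

∑<-cong-≗[<] : ∀ k {F G v} → (∀ i → F i ≗[< v ] G i) → ∑< k F ≗[< v ] ∑< k G
∑<-cong-≗[<] zero    F≗G n n<v = refl
∑<-cong-≗[<] (suc k) F≗G n n<v = cong₂ ℤ._+_ (∑<-cong-≗[<] k F≗G n n<v) (F≗G k n n<v)

∑<-0ₛ : ∀ k → ∑< k (λ _ → 0ₛ) ≗ 0ₛ
∑<-0ₛ zero    n = refl
∑<-0ₛ (suc k) n = cong (ℤ._+ 0ℤ) (∑<-0ₛ k n)

∑<-+ : ∀ k F G → ∑< k (λ i → F i +ₛ G i) ≗ ∑< k F +ₛ ∑< k G
∑<-+ zero    F G n = refl
∑<-+ (suc k) F G n = trans (cong (ℤ._+ (F k n ℤ.+ G k n)) (∑<-+ k F G n))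
                           (interchange (∑< k F n) (∑< k G n) (F k n) (G k n))

∑<-*ˡ : ∀ k c F → ∑< k (λ i → c *ₛ F i) ≗ c *ₛ ∑< k F
∑<-*ˡ zero    c F = ≗-sym (zeroʳ c)
∑<-*ˡ (suc k) c F = ≗-trans (+ₛ-cong (∑<-*ˡ k c F) ≗-refl) (≗-sym (distribˡ c (∑< k F) (F k)))

∑<-*ʳ : ∀ k c F → ∑< k (λ i → F i *ₛ c) ≗ ∑< k F *ₛ c
∑<-*ʳ k c F = ≗-trans (∑<-cong k (λ i → *-comm (F i) c)) (≗-trans (∑<-*ˡ k c F) (*-comm c (∑< k F)))

∑<-swap : ∀ K K′ (H : ℕ → ℕ → PS) →
  ∑< K (λ j → ∑< K′ (λ i → H i j)) ≗ ∑< K′ (λ i → ∑< K (λ j → H i j))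
∑<-swap zero    K′ H = ≗-sym (∑<-0ₛ K′)
∑<-swap (suc K) K′ H = ≗-trans (+ₛ-cong (∑<-swap K K′ H) ≗-refl)
  (≗-sym (∑<-+ K′ (λ i → ∑< K (λ j → H i j)) (λ i → H i K)))

∑<-telescope : ∀ k (G : ℕ → PS) → ∑< k (λ i → G i -ₛ G (suc i)) ≗ G 0 -ₛ G k
∑<-telescope zero    G n = sym (ℤP.+-inverseʳ (G 0 n))
∑<-telescope (suc k) G = ≗-trans (+ₛ-cong (∑<-telescope k G) ≗-refl)
  (solve 3 (λ a b c → (a :- b) :+ (b :- c) := a :- c) ≗-refl (G 0) (G k) (G (suc k)))

1≤2* : ∀ {m} → 1 ≤ m → 1 ≤ 2 * m
1≤2* {m} 1≤m = ℕP.≤-trans 1≤m (ℕP.m≤m+n m (m + 0))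

poch : ℕ → ℕ → PS
poch t m = ∏< m (λ i → 1ₛ +ₛ q^ (t + 2 * i))

poch-coeff₀ : ∀ t m → 1 ≤ t → poch t m 0 ≡ 1ℤ
poch-coeff₀ (suc t) m _ = ∏<-coeff₀-one m _ (λ _ → refl)

poch-+ : ∀ t a b → poch t (a + b) ≗ poch t a *ₛ poch (t + 2 * a) b
poch-+ t a zero    =
  ≗-trans (cong-app (cong (poch t) (ℕP.+-identityʳ a))) (≗-sym (*-identityʳ (poch t a)))
poch-+ t a (suc b) = begin
  poch t (a + suc b)
    ≡⟨ cong (poch t) (ℕP.+-suc a b) ⟩
  poch t (a + b) *ₛ (1ₛ +ₛ q^ (t + 2 * (a + b)))
    ≈⟨ *ₛ-cong (poch-+ t a b) (+ₛ-congˡ 1ₛ (q^-cong (exponent t a b))) ⟩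
  (poch t a *ₛ poch (t + 2 * a) b) *ₛ (1ₛ +ₛ q^ (t + 2 * a + 2 * b))
    ≈⟨ *-assoc (poch t a) (poch (t + 2 * a) b) (1ₛ +ₛ q^ (t + 2 * a + 2 * b)) ⟩
  poch t a *ₛ poch (t + 2 * a) (suc b) ∎
  where
  open ≗-Reasoning
  exponent : ∀ t a b → t + 2 * (a + b) ≡ t + 2 * a + 2 * b
  exponent = ℕ-Solver.solve-∀

poch-suc : ∀ t m → poch t (suc m) ≗ poch (t + 2) m *ₛ (1ₛ +ₛ q^ t)
poch-suc t m = ≗-trans (poch-+ t 1 m)
  (≗-trans (*-comm (poch t 1) (poch (t + 2) m)) (*ₛ-congˡ (poch (t + 2) m) first))
  where
  first : poch t 1 ≗ 1ₛ +ₛ q^ t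
  first = ≗-trans (*ₛ-identityˡ (1ₛ +ₛ q^ (t + 0))) (+ₛ-congˡ 1ₛ (q^-cong (ℕP.+-identityʳ t)))

∏<-odd : ∀ t m → ∏< m (λ i → q^ (t + 2 * suc i ∸ 1)) ≗ q^ (t * m + m * m)
∏<-odd t zero    = ≗-sym (≗-trans (q^-cong (trans (ℕP.+-identityʳ (t * 0)) (ℕP.*-zeroʳ t))) q^0≗1ₛ)
∏<-odd t (suc m) = ≗-trans (*ₛ-congʳ (q^ (t + 2 * suc m ∸ 1)) (∏<-odd t m))
  (≗-trans (q^-*ₛ-q^ (t * m + m * m) (t + 2 * suc m ∸ 1)) (q^-cong exponent))
  where
  next : ∀ t m → t + 2 * suc m ≡ suc (suc (t + 2 * m))
  next = ℕ-Solver.solve-∀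
  sum : ∀ t m → t * m + m * m + suc (t + 2 * m) ≡ t * suc m + suc m * suc m
  sum = ℕ-Solver.solve-∀
  exponent : t * m + m * m + (t + 2 * suc m ∸ 1) ≡ t * suc m + suc m * suc m
  exponent = trans (cong (λ e → t * m + m * m + (e ∸ 1)) (next t m)) (sum t m)

block : ℕ → ℕ → PS
block m t = ∏[ 1 , m ] (λ i → q^ (t + 2 * i ∸ 1)) /ₛ ∏[ 0 , m ] (λ i → 1ₛ +ₛ q^ (t + 2 * i))

block-normal : ∀ m t → block m t ≗ q^ (t * m + m * m) /ₛ poch t (suc m)
block-normal m t = /ₛ-cong (≗-trans (cong-app (∏[]≡∏< 1 m _)) (∏<-odd t m)) (cong-app (∏[]≡∏< 0 m _))

Γ : ℕ → ℕ → PS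
Γ m t = q^ (t * m + m * m) /ₛ poch t m

block-telescope : ∀ m t → 1 ≤ t → block m t *ₛ (1ₛ -ₛ q^ (2 * m)) ≗ Γ m t -ₛ Γ m (t + 2)
block-telescope m t 1≤t = *ₛ-cancelʳ D D₀≡1 (begin
  (block m t *ₛ W) *ₛ D
    ≈⟨ *ₛ-congʳ D (*ₛ-congʳ W (block-normal m t)) ⟩
  ((A /ₛ D) *ₛ W) *ₛ D
    ≈⟨ solve 3 (λ x w d → (x :* w) :* d := (x :* d) :* w) ≗-refl (A /ₛ D) W D ⟩
  ((A /ₛ D) *ₛ D) *ₛ W
    ≈⟨ *ₛ-congʳ W (/ₛ-*ₛ-cancel A D₀≡1) ⟩
  A *ₛ W
    ≈⟨ solve 3 (λ a b c → a :* (con 1ℤ :- b) := a :* (con 1ℤ :+ c :* b) :- (a :* b) :* (con 1ℤ :+ c))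
         ≗-refl A (q^ (2 * m)) (q^ t) ⟩
  A *ₛ (1ₛ +ₛ q^ t *ₛ q^ (2 * m)) -ₛ (A *ₛ q^ (2 * m)) *ₛ (1ₛ +ₛ q^ t)
    ≈⟨ -ₛ-cong (*ₛ-congˡ A (+ₛ-congˡ 1ₛ (q^-*ₛ-q^ t (2 * m))))
               (*ₛ-congʳ (1ₛ +ₛ q^ t) (≗-trans (q^-*ₛ-q^ (t * m + m * m) (2 * m))
                                               (q^-cong (exponent t m)))) ⟩
  A *ₛ E -ₛ A₂ *ₛ (1ₛ +ₛ q^ t)
    ≈⟨ -ₛ-cong (/ₛ-*ₛ-cancelˡ A E (poch-coeff₀ t m 1≤t))
               (/ₛ-*ₛ-cancelˡ A₂ (1ₛ +ₛ q^ t) (poch-coeff₀ (t + 2) m (ℕP.≤-trans 1≤t (ℕP.m≤m+n t 2)))) ⟨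
  Γ m t *ₛ (poch t m *ₛ E) -ₛ Γ m (t + 2) *ₛ (poch (t + 2) m *ₛ (1ₛ +ₛ q^ t))
    ≈⟨ -ₛ-cong {f = Γ m t *ₛ D} ≗-refl (*ₛ-congˡ (Γ m (t + 2)) (poch-suc t m)) ⟨
  Γ m t *ₛ D -ₛ Γ m (t + 2) *ₛ D
    ≈⟨ solve 3 (λ x y d → x :* d :- y :* d := (x :- y) :* d) ≗-refl (Γ m t) (Γ m (t + 2)) D ⟩
  (Γ m t -ₛ Γ m (t + 2)) *ₛ D ∎)
  where
  open ≗-Reasoning
  W = 1ₛ -ₛ q^ (2 * m)
  D = poch t (suc m)
  D₀≡1 = poch-coeff₀ t (suc m) 1≤t
  A = q^ (t * m + m * m)
  A₂ = q^ ((t + 2) * m + m * m)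
  E = 1ₛ +ₛ q^ (t + 2 * m)
  exponent : ∀ t m → t * m + m * m + 2 * m ≡ (t + 2) * m + m * m
  exponent = ℕ-Solver.solve-∀

block-sum : ∀ m t K → 1 ≤ m → 1 ≤ t →
  ∑< K (λ i → block m (t + 2 * i)) ≗ (Γ m t -ₛ Γ m (t + 2 * K)) /ₛ (1ₛ -ₛ q^ (2 * m))
block-sum m t K 1≤m 1≤t = *ₛ≗⇒≗/ₛ W (1ₛ-q^-coeff₀ (1≤2* 1≤m)) (begin
  ∑< K (λ i → block m (t + 2 * i)) *ₛ W  ≈⟨ ∑<-*ʳ K W (λ i → block m (t + 2 * i)) ⟨
  ∑< K (λ i → block m (t + 2 * i) *ₛ W)  ≈⟨ ∑<-cong K telescope ⟩
  ∑< K (λ i → G i -ₛ G (suc i))          ≈⟨ ∑<-telescope K G ⟩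
  G 0 -ₛ G K                             ≈⟨ -ₛ-cong {g = G K} (Γ-cong (ℕP.+-identityʳ t)) ≗-refl ⟩
  Γ m t -ₛ Γ m (t + 2 * K)               ∎)
  where
  open ≗-Reasoning
  W = 1ₛ -ₛ q^ (2 * m)
  G : ℕ → PS
  G i = Γ m (t + 2 * i)
  Γ-cong : ∀ {t t′} → t ≡ t′ → Γ m t ≗ Γ m t′
  Γ-cong t≡t′ = cong-app (cong (Γ m) t≡t′)
  next : ∀ t i → t + 2 * i + 2 ≡ t + 2 * suc i
  next = ℕ-Solver.solve-∀
  telescope : ∀ i → block m (t + 2 * i) *ₛ W ≗ G i -ₛ G (suc i)
  telescope i = ≗-trans (block-telescope m (t + 2 * i) (ℕP.≤-trans 1≤t (ℕP.m≤m+n t (2 * i))))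
                        (-ₛ-cong {f = G i} ≗-refl (Γ-cong (next t i)))

block-*-Γ : ∀ m₁ m₂ t → 1 ≤ t →
  block m₁ t *ₛ Γ m₂ (t + 2 * suc m₁) ≗ q^ (2 * m₂) *ₛ block (m₁ + m₂) t
block-*-Γ m₁ m₂ t 1≤t = begin
  block m₁ t *ₛ Γ m₂ t′
    ≈⟨ *ₛ-congʳ (Γ m₂ t′) (block-normal m₁ t) ⟩
  (q^ a /ₛ poch t (suc m₁)) *ₛ (q^ b /ₛ poch t′ m₂)
    ≈⟨ /ₛ-*ₛ-/ₛ (q^ a) (q^ b) (poch-coeff₀ t (suc m₁) 1≤t)
                               (poch-coeff₀ t′ m₂ (ℕP.≤-trans 1≤t (ℕP.m≤m+n t _))) ⟩
  (q^ a *ₛ q^ b) /ₛ (poch t (suc m₁) *ₛ poch t′ m₂)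
    ≈⟨ /ₛ-cong (≗-trans (q^-*ₛ-q^ a b) (q^-cong (exponent m₁ m₂ t))) (≗-sym (poch-+ t (suc m₁) m₂)) ⟩
  q^ (2 * m₂ + c) /ₛ poch t (suc M)
    ≈⟨ *ₛ-congʳ (invₛ (poch t (suc M))) (q^-*ₛ-q^ (2 * m₂) c) ⟨
  (q^ (2 * m₂) *ₛ q^ c) /ₛ poch t (suc M)
    ≈⟨ *-assoc (q^ (2 * m₂)) (q^ c) (invₛ (poch t (suc M))) ⟩
  q^ (2 * m₂) *ₛ (q^ c /ₛ poch t (suc M))
    ≈⟨ *ₛ-congˡ (q^ (2 * m₂)) (block-normal M t) ⟨
  q^ (2 * m₂) *ₛ block M t ∎
  where
  open ≗-Reasoning
  M  = m₁ + m₂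
  t′ = t + 2 * suc m₁
  a  = t * m₁ + m₁ * m₁
  b  = t′ * m₂ + m₂ * m₂
  c  = t * M + M * M
  exponent : ∀ m₁ m₂ t →
    t * m₁ + m₁ * m₁ + ((t + 2 * suc m₁) * m₂ + m₂ * m₂)
      ≡ 2 * m₂ + (t * (m₁ + m₂) + (m₁ + m₂) * (m₁ + m₂))
  exponent = ℕ-Solver.solve-∀

Γ-tail-≗[<]0 : ∀ m s K → 1 ≤ m → Γ m (s + 2 * K) ≗[< K ] 0ₛ
Γ-tail-≗[<]0 m s K 1≤m = ≗[<]-weaken K≤exponent (q^-*ₛ-≗[<]0 _ (invₛ (poch t m)))
  where
  t = s + 2 * K
  K≤exponent : K ≤ t * m + m * m
  K≤exponent = begin
    K                        ≤⟨ ℕP.m≤m+n K (K + 0) ⟩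
    2 * K                  ≤⟨ ℕP.m≤n+m (2 * K) s ⟩
    t                        ≤⟨ ℕP.m≤m*n t m {{ℕ.>-nonZero 1≤m}} ⟩
    t * m                  ≤⟨ ℕP.m≤m+n (t * m) (m * m) ⟩
    t * m + m * m      ∎
    where open ℕP.≤-Reasoning

drop-tail : ∀ c x d {y v} → y ≗[< v ] 0ₛ → c *ₛ ((x -ₛ y) /ₛ d) ≗[< v ] c *ₛ (x /ₛ d)
drop-tail c x d y≗0 =
  *ₛ-cong-≗[<] {f = c} (λ _ _ → refl) (*ₛ-cong-≗[<] {g = invₛ d} (-ₛ-≗[<]0 x y≗0) (λ _ _ → refl))

partialLHS-≗ : ∀ m₁ m₂ K →
  partialLHS m₁ m₂ K ≗ ∑< K (λ i → ∑< K (λ j → term m₁ m₂ (suc i) (suc j)))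
partialLHS-≗ m₁ m₂ K = ≗-trans (cong-app (∑[]≡∑< 1 K _))
  (≗-trans (∑<-cong K (λ j → cong-app (∑[]≡∑< 1 K _)))
           (∑<-swap K K (λ i j → term m₁ m₂ (suc i) (suc j))))

inner-sum : ∀ m₁ m₂ k₁ K → 1 ≤ m₂ →
  ∑< K (λ j → term m₁ m₂ k₁ (suc j))
    ≗ block m₁ (2 * k₁) *ₛ ((Γ m₂ (2 * k₁ + 2 * suc m₁) -ₛ Γ m₂ (2 * k₁ + 2 * suc m₁ + 2 * K))
                               /ₛ (1ₛ -ₛ q^ (2 * m₂)))
inner-sum m₁ m₂ k₁ K 1≤m₂ =
  ≗-trans (∑<-cong K (λ j → *ₛ-congˡ (block m₁ (2 * k₁))
                                      (cong-app (cong (block m₂) (exponent k₁ j m₁)))))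
  (≗-trans (∑<-*ˡ K (block m₁ (2 * k₁)) (λ j → block m₂ (t + 2 * j)))
           (*ₛ-congˡ (block m₁ (2 * k₁)) (block-sum m₂ t K 1≤m₂ 1≤t)))
  where
  t = 2 * k₁ + 2 * suc m₁
  1≤t : 1 ≤ t
  1≤t = ℕP.≤-trans (s≤s z≤n) (ℕP.m≤n+m (2 * suc m₁) (2 * k₁))
  exponent : ∀ k j m → 2 * k + 2 * suc j + 2 * m ≡ 2 * k + 2 * suc m + 2 * j
  exponent = ℕ-Solver.solve-∀

outer-summand : ∀ m₁ m₂ k₁ K → 1 ≤ m₂ → 1 ≤ k₁ →
  block m₁ (2 * k₁) *ₛ ((Γ m₂ (2 * k₁ + 2 * suc m₁) -ₛ Γ m₂ (2 * k₁ + 2 * suc m₁ + 2 * K))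
                          /ₛ (1ₛ -ₛ q^ (2 * m₂)))
    ≗[< K ] (q^ (2 * m₂) /ₛ (1ₛ -ₛ q^ (2 * m₂))) *ₛ block (m₁ + m₂) (2 * k₁)
outer-summand m₁ m₂ k₁ K 1≤m₂ 1≤k₁ = begin
  B *ₛ ((Γ m₂ t -ₛ Γ m₂ (t + 2 * K)) /ₛ W)
    ≈⟨ drop-tail B (Γ m₂ t) W (Γ-tail-≗[<]0 m₂ t K 1≤m₂) ⟩
  B *ₛ (Γ m₂ t /ₛ W)
    ≈⟨ ≗⇒≗[<] (solve 3 (λ b g i → b :* (g :* i) := i :* (b :* g)) ≗-refl B (Γ m₂ t) (invₛ W)) ⟩
  invₛ W *ₛ (B *ₛ Γ m₂ t)
    ≈⟨ ≗⇒≗[<] (*ₛ-congˡ (invₛ W) (block-*-Γ m₁ m₂ (2 * k₁) (1≤2* 1≤k₁))) ⟩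
  invₛ W *ₛ (q^ (2 * m₂) *ₛ block (m₁ + m₂) (2 * k₁))
    ≈⟨ ≗⇒≗[<] (solve 3 (λ i a b → i :* (a :* b) := (a :* i) :* b) ≗-refl
                 (invₛ W) (q^ (2 * m₂)) (block (m₁ + m₂) (2 * k₁))) ⟩
  (q^ (2 * m₂) /ₛ W) *ₛ block (m₁ + m₂) (2 * k₁) ∎
  where
  open SetoidReasoning (≗[<]-setoid K)
  B = block m₁ (2 * k₁)
  t = 2 * k₁ + 2 * suc m₁
  W = 1ₛ -ₛ q^ (2 * m₂)

rhs-≗ : ∀ m₁ m₂ → 1 ≤ m₂ →
  rhs m₁ m₂ ≗ (q^ (2 * m₂) /ₛ (1ₛ -ₛ q^ (2 * m₂))) *ₛ (Γ (m₁ + m₂) 2 /ₛ (1ₛ -ₛ q^ (2 * (m₁ + m₂))))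
rhs-≗ m₁ m₂ 1≤m₂ = begin
  rhs m₁ m₂
    ≈⟨ /ₛ-cong (*ₛ-congˡ (q^ (2 * M) *ₛ q^ (2 * m₂)) (≗-trans (cong-app (∏[]≡∏< 1 M _)) (∏<-odd 0 M)))
               (*ₛ-congˡ (Wₘ *ₛ W₂) (≗-trans (cong-app (∏[]≡∏< 1 M _))
                                              (∏<-cong M (λ i → +ₛ-congˡ 1ₛ (q^-cong (ℕP.*-suc 2 i)))))) ⟩
  ((q^ (2 * M) *ₛ q^ (2 * m₂)) *ₛ q^ (M * M)) /ₛ ((Wₘ *ₛ W₂) *ₛ poch 2 M)
    ≈⟨ *ₛ-cong numerator (≗-trans (invₛ-*ₛ (*ₛ-coeff₀-one Wₘ W₂ Wₘ₀≡1 W₂₀≡1) (poch-coeff₀ 2 M (s≤s z≤n)))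
                                  (*ₛ-congʳ (invₛ (poch 2 M)) (invₛ-*ₛ Wₘ₀≡1 W₂₀≡1))) ⟩
  (q^ (2 * m₂) *ₛ q^ (2 * M + M * M)) *ₛ ((invₛ Wₘ *ₛ invₛ W₂) *ₛ invₛ (poch 2 M))
    ≈⟨ solve 5 (λ a x i j p → (a :* x) :* ((i :* j) :* p) := (a :* j) :* ((x :* p) :* i)) ≗-refl
         (q^ (2 * m₂)) (q^ (2 * M + M * M)) (invₛ Wₘ) (invₛ W₂) (invₛ (poch 2 M)) ⟩
  (q^ (2 * m₂) /ₛ W₂) *ₛ (Γ M 2 /ₛ Wₘ) ∎
  where
  open ≗-Reasoning
  M  = m₁ + m₂
  Wₘ = 1ₛ -ₛ q^ (2 * M)
  W₂ = 1ₛ -ₛ q^ (2 * m₂)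
  Wₘ₀≡1 = 1ₛ-q^-coeff₀ (1≤2* (ℕP.≤-trans 1≤m₂ (ℕP.m≤n+m m₂ m₁)))
  W₂₀≡1 = 1ₛ-q^-coeff₀ (1≤2* 1≤m₂)
  exponent : ∀ m₂ M → 2 * M + 2 * m₂ + M * M ≡ 2 * m₂ + (2 * M + M * M)
  exponent = ℕ-Solver.solve-∀
  numerator : (q^ (2 * M) *ₛ q^ (2 * m₂)) *ₛ q^ (M * M) ≗ q^ (2 * m₂) *ₛ q^ (2 * M + M * M)
  numerator = ≗-trans (*ₛ-congʳ (q^ (M * M)) (q^-*ₛ-q^ (2 * M) (2 * m₂)))
    (≗-trans (q^-*ₛ-q^ (2 * M + 2 * m₂) (M * M))
    (≗-trans (q^-cong (exponent m₂ M)) (≗-sym (q^-*ₛ-q^ (2 * m₂) (2 * M + M * M)))))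

partialLHS-≗[<]-rhs : ∀ m₁ m₂ K → 1 ≤ m₂ → partialLHS m₁ m₂ K ≗[< K ] rhs m₁ m₂
partialLHS-≗[<]-rhs m₁ m₂ K 1≤m₂ = begin
  partialLHS m₁ m₂ K
    ≈⟨ ≗⇒≗[<] (≗-trans (partialLHS-≗ m₁ m₂ K) (∑<-cong K (λ i → inner-sum m₁ m₂ (suc i) K 1≤m₂))) ⟩
  ∑< K (λ i → block m₁ (2 * suc i) *ₛ ((Γ m₂ (t i) -ₛ Γ m₂ (t i + 2 * K)) /ₛ W₂))
    ≈⟨ ∑<-cong-≗[<] K (λ i → outer-summand m₁ m₂ (suc i) K 1≤m₂ (s≤s z≤n)) ⟩
  ∑< K (λ i → c *ₛ block M (2 * suc i))
    ≈⟨ ≗⇒≗[<] (≗-trans (∑<-*ˡ K c (λ i → block M (2 * suc i)))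
                       (*ₛ-congˡ c (∑<-cong K (λ i → cong-app (cong (block M) (ℕP.*-suc 2 i)))))) ⟩
  c *ₛ ∑< K (λ i → block M (2 + 2 * i))
    ≈⟨ ≗⇒≗[<] (*ₛ-congˡ c (block-sum M 2 K 1≤M (s≤s z≤n))) ⟩
  c *ₛ ((Γ M 2 -ₛ Γ M (2 + 2 * K)) /ₛ Wₘ)
    ≈⟨ drop-tail c (Γ M 2) Wₘ (Γ-tail-≗[<]0 M 2 K 1≤M) ⟩
  c *ₛ (Γ M 2 /ₛ Wₘ)
    ≈⟨ ≗⇒≗[<] (≗-sym (rhs-≗ m₁ m₂ 1≤m₂)) ⟩
  rhs m₁ m₂ ∎
  where
  open SetoidReasoning (≗[<]-setoid K)
  M  = m₁ + m₂
  1≤M = ℕP.≤-trans 1≤m₂ (ℕP.m≤n+m m₂ m₁)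
  W₂ = 1ₛ -ₛ q^ (2 * m₂)
  Wₘ = 1ₛ -ₛ q^ (2 * M)
  c  = q^ (2 * m₂) /ₛ W₂
  t : ℕ → ℕ
  t i = 2 * suc i + 2 * suc m₁

lemma4p3 : (m₁ m₂ : ℕ) → 1 ≤ m₁ → 1 ≤ m₂ →
    (n : ℕ) → ∃[ N ] ((K : ℕ) → N ≤ K → partialLHS m₁ m₂ K n ≡ rhs m₁ m₂ n)
lemma4p3 m₁ m₂ _ 1≤m₂ n = suc n , λ K n<K → partialLHS-≗[<]-rhs m₁ m₂ K 1≤m₂ n n<K
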